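{- Let $G=(V,E)$ be a bipartite graph with bipartition $(X,Y)$ such that every vertex of degree at least 3 lies in $X$. Suppose a list $L_{uv}$ of colours is associated to each edge $uv\in E$, such that for every $u\in X$ all edges incident to $u$ have the same list. If $|L_{uv}|\geq \max\{\deg_G(u),\deg_G(v)\}$ for every edge $uv\in E$, then there is a (proper) edge-colouring $\pi$ of $G$ with $\pi(uv)\in L_{uv}$ for every edge $uv\in E$.
   Context: An edge-colouring is an assignment of colours to edges such that adjacent edges (edges sharing an endpoint) receive distinct colours. Graphs are finite and simple. -}

module Defs where

open import Data.Nat using (ℕ; _≤_; _⊔_)
open import Data.Bool using (Bool; true; false; if_then_else_)
open import Data.Fin using (Fin)
open import Data.List using (List; map; allFin; length)
open import Data.Nat.ListAction using (sum)
open import Data.List.Membership.Propositional using (_∈_)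
open import Data.List.Relation.Unary.Unique.Propositional using (Unique)
open import Data.Product using (_×_; ∃)
open import Relation.Binary.PropositionalEquality using (_≡_; _≢_)
open import Relation.Nullary using (¬_)
open import Function.Bundles using (_⇔_)

-- A finite simple bipartite graph with bipartition (X , Y), X = Fin m, Y = Fin n.
-- Adj x y = true  iff  xy is an edge.  (Simple: at most one edge per pair, no loops.)
BipGraph : ℕ → ℕ → Set
BipGraph m n = Fin m → Fin n → Bool

Edge : ∀ {m n} → BipGraph m n → Fin m → Fin n → Set
Edge G x y = G x y ≡ true

indicator : Bool → ℕ
indicator b = if b then 1 else 0

degX : ∀ {m n} → BipGraph m n → Fin m → ℕ
degX {n = n} G x = sum (map (λ y → indicator (G x y)) (allFin n))

degY : ∀ {m n} → BipGraph m n → Fin n → ℕ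
degY {m = m} G y = sum (map (λ x → indicator (G x y)) (allFin m))

-- A list of colours on each edge (colours are natural numbers); a list is a finite set of
-- colours, represented by a duplicate-free list so that its length is its cardinality.
-- Values of L at non-edges are irrelevant.
ListAssignment : ℕ → ℕ → Set
ListAssignment m n = Fin m → Fin n → List ℕ

IsProperListColouring : ∀ {m n} → BipGraph m n → ListAssignment m n → (Fin m → Fin n → ℕ) → Set
IsProperListColouring G L π =
  (∀ x y → Edge G x y → π x y ∈ L x y)
  × (∀ x y y′ → Edge G x y → Edge G x y′ → y ≢ y′ → π x y ≢ π x y′)
  × (∀ x x′ y → Edge G x y → Edge G x′ y → x ≢ x′ → π x y ≢ π x′ y)

-- Colour G minus a vertex x₀ ∈ X by induction; every neighbour y of x₀
-- has at most one further neighbour, and that edge forbids at most one colour for x₀y.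
-- Colouring the edges at x₀ then asks for distinct representatives, from the common list A
-- of x₀ with |A| ≥ deg x₀, of the sets A minus one forbidden colour each. They exist
-- greedily when A has a spare colour or some neighbour has no forbidden colour in A, and
-- also when two neighbours y, y′ have different forbidden colours. If the first two
-- neighbours y₁, y₂ of x₀ have further neighbours x₁ ≠ x₂, colour instead the graph in which
-- the edge x₂y₂ is replaced by x₂y₁: it still satisfies the hypotheses, and its colourings
-- give x₁y₁ and x₂y₂ different colours.
module Submission where

open import Data.Bool using (Bool; true; false)
import Data.Bool.Properties as Bool
open import Data.Fin using (Fin; zero; suc)
open import Data.Fin.Permutation as Perm using (Permutation′; _⟨$⟩ʳ_; _⟨$⟩ˡ_; inverseʳ; inverseˡ)
open import Data.Fin.Permutation.Components using (transpose)
import Data.Fin.Properties as Fin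
open import Data.List using (List; []; _∷_; length; lookup; filter; map; allFin)
open import Data.List.Membership.Propositional using (_∈_; _∉_; find)
open import Data.List.Membership.Propositional.Properties
  using (∈-lookup; ∈-filter⁺; ∈-filter⁻; ∈-allFin; ∈-map⁺; ∈-map⁻; ∈-length)
open import Data.List.Membership.Setoid.Properties using (index-injective)
open import Data.List.Properties using (length-map; map-tabulate)
open import Data.List.Relation.Binary.Permutation.Propositional using (↭-swap; ↭-refl)
open import Data.List.Relation.Binary.Permutation.Propositional.Properties using (∈-resp-↭)
open import Data.List.Relation.Binary.Subset.Propositional using (_⊆_)
open import Data.List.Relation.Unary.All as All using (all?; _∷_)
open import Data.List.Relation.Unary.All.Properties using (¬All⇒Any¬)
open import Data.List.Relation.Unary.AllPairs as AllPairs using (_∷_)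
open import Data.List.Relation.Unary.Any using (here; there)
open import Data.List.Relation.Unary.Unique.Propositional using (Unique)
open import Data.List.Relation.Unary.Unique.Propositional.Properties
  using (filter⁺; map⁺; allFin⁺; Unique[x∷xs]⇒x∉xs)
open import Data.Nat using (ℕ; zero; suc; _+_; _≤_; _<_; _⊔_; s≤s)
import Data.Nat.Properties as ℕ
open import Data.Nat.Properties
  using (≤-trans; ≤-reflexive; ≤-pred; <⇒≱; ≰⇒>; +-suc; +-monoˡ-≤; m+n≤o⇒m≤o; m≤n+m;
         m≤m⊔n; m≤n⊔m; ⊔-lub; ⊔-monoʳ-≤; module ≤-Reasoning)
open import Data.Nat.ListAction using (sum)
open import Data.Product using (∃; _×_; _,_; proj₁; proj₂)
open import Data.Sum using (_⊎_; inj₁; inj₂)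
open import Data.Vec.Functional using (tail; updateAt) renaming (_∷_ to _◂_)
open import Data.Vec.Functional.Properties using (updateAt-updates; updateAt-minimal)
open import Function using (_∘_; Injective; case_of_)
open import Function.Bundles using (_⇔_; Equivalence)
open import Relation.Binary.Definitions using (DecidableEquality)
open import Relation.Binary.PropositionalEquality
open import Relation.Nullary using (¬_; Dec; yes; no; ¬?; contradiction)
open import Relation.Nullary.Decidable using (dec-true; dec-false)

open import Defs

module _ {A : Set} where

  Unique⇒lookup-injective : {xs : List A} → Unique xs → Injective _≡_ _≡_ (lookup xs)
  Unique⇒lookup-injective {_ ∷ _} _        {zero}  {zero}  _  = refl
  Unique⇒lookup-injective {_ ∷ _} (x∉ ∷ _) {zero}  {suc j} eq = contradiction eq (All.lookup x∉ (∈-lookup j))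
  Unique⇒lookup-injective {_ ∷ _} (x∉ ∷ _) {suc i} {zero}  eq = contradiction (sym eq) (All.lookup x∉ (∈-lookup i))
  Unique⇒lookup-injective {_ ∷ _} (_ ∷ u)  {suc i} {suc j} eq = cong suc (Unique⇒lookup-injective u eq)

  length-mono-⊆ : {xs ys : List A} → Unique xs → xs ⊆ ys → length xs ≤ length ys
  length-mono-⊆ u xs⊆ys = Fin.injective⇒≤ λ eq →
    Unique⇒lookup-injective u (index-injective (setoid A) (xs⊆ys (∈-lookup _)) (xs⊆ys (∈-lookup _)) eq)

  ⊆-swap : ∀ {x y : A} {xs} → x ∷ y ∷ xs ⊆ y ∷ x ∷ xs
  ⊆-swap = ∈-resp-↭ (↭-swap _ _ ↭-refl)

  Unique-swap : ∀ {x y : A} {xs} → Unique (x ∷ y ∷ xs) → Unique (y ∷ x ∷ xs)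
  Unique-swap ((x≢y ∷ x∉xs) ∷ y∉xs ∷ u) = ((x≢y ∘ sym) ∷ y∉xs) ∷ x∉xs ∷ u

  length≤1⇒≡ : {xs : List A} {a b : A} → length xs ≤ 1 → a ∈ xs → b ∈ xs → a ≡ b
  length≤1⇒≡ {xs = _ ∷ []} _ (here refl) (here refl) = refl
  length≤1⇒≡ {xs = _ ∷ _ ∷ _} (s≤s ())

module DecidableLists {A : Set} (_≟_ : DecidableEquality A) where

  open import Data.List.Membership.DecPropositional _≟_ using (_∈?_)

  pigeonhole : {xs ys : List A} → Unique xs → length ys < length xs → ∃ λ x → x ∈ xs × x ∉ ys
  pigeonhole {xs} {ys} u ys<xs with all? (_∈? ys) xs
  ... | yes xs⊆ys = contradiction (length-mono-⊆ u (All.lookup xs⊆ys)) (<⇒≱ ys<xs)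
  ... | no xs⊈ys = find (¬All⇒Any¬ (_∈? ys) xs xs⊈ys)

  infixl 6 _∖_
  _∖_ : List A → A → List A
  xs ∖ x = filter (λ y → ¬? (y ≟ x)) xs

  ∈-∖⁺ : {x y : A} {xs : List A} → y ∈ xs → y ≢ x → y ∈ xs ∖ x
  ∈-∖⁺ = ∈-filter⁺ (λ y → ¬? (y ≟ _))

  ∈-∖⁻ : {x y : A} {xs : List A} → y ∈ xs ∖ x → y ∈ xs × y ≢ x
  ∈-∖⁻ = ∈-filter⁻ (λ y → ¬? (y ≟ _))

  ∖-unique : {x : A} {xs : List A} → Unique xs → Unique (xs ∖ x)
  ∖-unique = filter⁺ (λ y → ¬? (y ≟ _))

  length-∖ : {x : A} {xs : List A} → Unique xs → length xs ≤ suc (length (xs ∖ x))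
  length-∖ {x} u = length-mono-⊆ u λ {y} y∈xs → case y ≟ x of λ where
    (yes refl) → here refl
    (no y≢x) → there (∈-∖⁺ y∈xs y≢x)

module Representatives {I : Set} (_≟ᴵ_ : DecidableEquality I) where

  open import Data.List.Membership.DecPropositional ℕ._≟_ using (_∈?_)
  open DecidableLists ℕ._≟_

  record IsSDR (A : List ℕ) (F : I → List ℕ) (S : List I) (g : I → ℕ) : Set where
    field
      chosen   : ∀ {s} → s ∈ S → g s ∈ A
      avoids   : ∀ {s} → s ∈ S → g s ∉ F s
      distinct : ∀ {s t} → s ∈ S → t ∈ S → s ≢ t → g s ≢ g t

  open IsSDR

  _[_≔_] : (I → ℕ) → I → ℕ → I → ℕ
  (g [ v ≔ a ]) t with t ≟ᴵ v
  ... | yes _ = a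
  ... | no _ = g t

  [≔]-same : ∀ g v a → (g [ v ≔ a ]) v ≡ a
  [≔]-same g v a with v ≟ᴵ v
  ... | yes _ = refl
  ... | no v≢v = contradiction refl v≢v

  [≔]-other : ∀ g {v t} a → t ≢ v → (g [ v ≔ a ]) t ≡ g t
  [≔]-other g {v} {t} a t≢v with t ≟ᴵ v
  ... | yes t≡v = contradiction t≡v t≢v
  ... | no _ = refl

  IsSDR-⊆ : ∀ {A F S T g} → IsSDR A F T g → S ⊆ T → IsSDR A F S g
  IsSDR-⊆ sdr S⊆T = record
    { chosen = chosen sdr ∘ S⊆T
    ; avoids = avoids sdr ∘ S⊆T
    ; distinct = λ s∈ t∈ → distinct sdr (S⊆T s∈) (S⊆T t∈)
    }

  IsSDR-∷ : ∀ {P A F S g v a} → IsSDR P F S g → P ⊆ A → v ∉ S →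
            a ∈ A → a ∉ F v → (∀ {s} → s ∈ S → g s ≢ a) →
            IsSDR A F (v ∷ S) (g [ v ≔ a ])
  IsSDR-∷ {A = A} {F} {S} {g} {v} {a} sdr P⊆A v∉S a∈A a∉Fv g≢a = record
    { chosen = λ { (here refl) → subst (_∈ A) (sym new) a∈A
                 ; (there s∈) → subst (_∈ A) (sym (old s∈)) (P⊆A (chosen sdr s∈)) }
    ; avoids = λ { {s} (here refl) → subst (_∉ F s) (sym new) a∉Fv
                 ; {s} (there s∈) → subst (_∉ F s) (sym (old s∈)) (avoids sdr s∈) }
    ; distinct = distinct′
    }
    where
      new : (g [ v ≔ a ]) v ≡ a
      new = [≔]-same g v a
      old : ∀ {s} → s ∈ S → (g [ v ≔ a ]) s ≡ g s
      old s∈ = [≔]-other g a λ { refl → v∉S s∈ }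
      distinct′ : ∀ {s t} → s ∈ v ∷ S → t ∈ v ∷ S → s ≢ t → (g [ v ≔ a ]) s ≢ (g [ v ≔ a ]) t
      distinct′ (here refl) (here refl) s≢t = contradiction refl s≢t
      distinct′ (here refl) (there t∈) _ eq = g≢a t∈ (trans (sym (old t∈)) (trans (sym eq) new))
      distinct′ (there s∈) (here refl) _ eq = g≢a s∈ (trans (sym (old s∈)) (trans eq new))
      distinct′ (there s∈) (there t∈) s≢t eq =
        distinct sdr s∈ t∈ s≢t (trans (sym (old s∈)) (trans eq (old t∈)))

  sdr-greedy : ∀ {A F} S → Unique A → Unique S →
               (∀ {s} → s ∈ S → length (F s) + length S ≤ length A) → ∃ (IsSDR A F S)
  sdr-greedy [] _ _ _ = (λ _ → 0) , record { chosen = λ () ; avoids = λ () ; distinct = λ () }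
  sdr-greedy {A} (s ∷ S) uA us∷S@(_ ∷ uS) fits =
    let a , a∈A , a∉Fs = pigeonhole uA (head-fits (fits (here refl)))
        g , sdr = sdr-greedy {A ∖ a} S (∖-unique uA) uS (λ t∈ → tail-fits a (fits (there t∈)))
    in g [ s ≔ a ] , IsSDR-∷ sdr (proj₁ ∘ ∈-∖⁻ {xs = A}) (Unique[x∷xs]⇒x∉xs us∷S) a∈A a∉Fs
                       (λ t∈ → proj₂ (∈-∖⁻ {xs = A} (chosen sdr t∈)))
    where
      head-fits : ∀ {f} → f + suc (length S) ≤ length A → f < length A
      head-fits h = m+n≤o⇒m≤o _ (subst (_≤ length A) (+-suc _ _) h)
      tail-fits : ∀ {f} a → f + suc (length S) ≤ length A → f + length S ≤ length (A ∖ a)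
      tail-fits a h = ≤-pred (subst (_≤ suc (length (A ∖ a))) (+-suc _ _) (≤-trans h (length-∖ uA)))

  sdr-free-head : ∀ {A F y} S → Unique A → Unique (y ∷ S) →
                  (∀ {s} → s ∈ S → length (F s) ≤ 1) → length (y ∷ S) ≤ length A →
                  (∀ {c} → c ∈ F y → c ∉ A) → ∃ (IsSDR A F (y ∷ S))
  sdr-free-head {A} {y = y} S uA uy∷S@(_ ∷ uS) small fits Fy∩A=∅ =
    let g , sdr = sdr-greedy S uA uS (λ s∈ → ≤-trans (+-monoˡ-≤ (length S) (small s∈)) fits)
        a , a∈A , a∉gS = pigeonhole uA (subst (_< length A) (sym (length-map g S)) fits)
    in g [ y ≔ a ] , IsSDR-∷ sdr (λ a∈ → a∈) (Unique[x∷xs]⇒x∉xs uy∷S) a∈A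
                       (λ a∈Fy → Fy∩A=∅ a∈Fy a∈A)
                       (λ s∈ gs≡a → a∉gS (subst (_∈ map g S) gs≡a (∈-map⁺ g s∈)))

  -- y′ takes the colour c, after which y has no forbidden colour left in A ∖ c.
  sdr-differing-heads : ∀ {A F y y′ c} S → Unique A → Unique (y ∷ y′ ∷ S) →
                        (∀ {s} → s ∈ y′ ∷ S → length (F s) ≤ 1) → length (y ∷ y′ ∷ S) ≤ length A →
                        (∀ {d} → d ∈ F y → d ≡ c) → c ∉ F y′ → ∃ (IsSDR A F (y ∷ y′ ∷ S))
  sdr-differing-heads {A} {y = y} {y′} {c} S uA uy∷y′∷S@((y≢y′ ∷ y∉S) ∷ uy′∷S@(_ ∷ uS))
                      small fits Fy⊆c c∉Fy′ with c ∈? A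
  ... | no c∉A =
    sdr-free-head (y′ ∷ S) uA uy∷y′∷S small fits λ d∈Fy → subst (_∉ A) (sym (Fy⊆c d∈Fy)) c∉A
  ... | yes c∈A =
    let g , sdr = sdr-free-head S (∖-unique uA) (y∉S ∷ uS) (small ∘ there) fits-∖
                    λ d∈Fy d∈A∖c → proj₂ (∈-∖⁻ {xs = A} d∈A∖c) (Fy⊆c d∈Fy)
    in g [ y′ ≔ c ] , IsSDR-⊆ (IsSDR-∷ sdr (proj₁ ∘ ∈-∖⁻ {xs = A}) y′∉y∷S c∈A c∉Fy′
                                 (λ s∈ → proj₂ (∈-∖⁻ {xs = A} (chosen sdr s∈))))
                              ⊆-swap
    where
      fits-∖ : length (y ∷ S) ≤ length (A ∖ c)
      fits-∖ = ≤-pred (≤-trans fits (length-∖ uA))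
      y′∉y∷S : y′ ∉ y ∷ S
      y′∉y∷S (here refl) = y≢y′ refl
      y′∉y∷S (there y′∈S) = Unique[x∷xs]⇒x∉xs uy′∷S y′∈S

transpose-here : ∀ {n} (i j : Fin n) → transpose i j i ≡ j
transpose-here i j rewrite dec-true (i Fin.≟ i) refl = refl

transpose-there : ∀ {n} (i j : Fin n) → transpose i j j ≡ i
transpose-there i j with j Fin.≟ i
... | yes refl = refl
... | no _ rewrite dec-true (j Fin.≟ j) refl = refl

transpose-other : ∀ {n} {i j k : Fin n} → k ≢ i → k ≢ j → transpose i j k ≡ k
transpose-other {i = i} {j} {k} k≢i k≢j
  rewrite dec-false (k Fin.≟ i) k≢i | dec-false (k Fin.≟ j) k≢j = refl

⟨$⟩ʳ-injective : ∀ {n} (π : Permutation′ n) → Injective _≡_ _≡_ (π ⟨$⟩ʳ_)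
⟨$⟩ʳ-injective π eq = trans (sym (inverseˡ π)) (trans (cong (π ⟨$⟩ˡ_) eq) (inverseˡ π))

⟨$⟩ˡ-injective : ∀ {n} (π : Permutation′ n) → Injective _≡_ _≡_ (π ⟨$⟩ˡ_)
⟨$⟩ˡ-injective π eq = trans (sym (inverseʳ π)) (trans (cong (π ⟨$⟩ʳ_) eq) (inverseʳ π))

support : ∀ {k} → (Fin k → Bool) → List (Fin k)
support {k} f = filter (λ i → f i Bool.≟ true) (allFin k)

module _ {k} {f : Fin k → Bool} where

  ∈-support⁺ : ∀ {i} → f i ≡ true → i ∈ support f
  ∈-support⁺ = ∈-filter⁺ (λ i → f i Bool.≟ true) {xs = allFin k} (∈-allFin _)

  ∈-support⁻ : ∀ {i} → i ∈ support f → f i ≡ true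
  ∈-support⁻ = proj₂ ∘ ∈-filter⁻ (λ i → f i Bool.≟ true) {xs = allFin k}

  support-unique : Unique (support f)
  support-unique = filter⁺ (λ i → f i Bool.≟ true) (allFin⁺ k)

sum-indicator≡length-filter : ∀ {A : Set} (f : A → Bool) xs →
                              sum (map (indicator ∘ f) xs) ≡ length (filter (λ x → f x Bool.≟ true) xs)
sum-indicator≡length-filter f [] = refl
sum-indicator≡length-filter f (x ∷ xs) with f x
... | true = cong suc (sum-indicator≡length-filter f xs)
... | false = sum-indicator≡length-filter f xs

length-support-mono : ∀ {k} {f g : Fin k → Bool} → (∀ {i} → f i ≡ true → g i ≡ true) →
                      length (support f) ≤ length (support g)
length-support-mono {f = f} {g} f⇒g =
  length-mono-⊆ (support-unique {f = f}) (∈-support⁺ {f = g} ∘ f⇒g ∘ ∈-support⁻ {f = f})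

length-support-∘ : ∀ {k} (f : Fin k → Bool) {σ : Fin k → Fin k} → Injective _≡_ _≡_ σ →
                   length (support (f ∘ σ)) ≤ length (support f)
length-support-∘ f {σ} σ-inj = begin
  length (support (f ∘ σ))         ≡⟨ length-map σ (support (f ∘ σ)) ⟨
  length (map σ (support (f ∘ σ))) ≤⟨ length-mono-⊆ (map⁺ σ-inj (support-unique {f = f ∘ σ})) image⊆ ⟩
  length (support f)               ∎
  where
    open ≤-Reasoning
    image⊆ : map σ (support (f ∘ σ)) ⊆ support f
    image⊆ i∈ with j , j∈ , refl ← ∈-map⁻ σ i∈ = ∈-support⁺ {f = f} (∈-support⁻ {f = f ∘ σ} j∈)

sum-allFin-suc : ∀ {k} (h : Fin (suc k) → ℕ) →
                 sum (map h (allFin (suc k))) ≡ h zero + sum (map (h ∘ suc) (allFin k))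
sum-allFin-suc h =
  cong (λ xs → h zero + sum xs) (trans (map-tabulate suc h) (sym (map-tabulate (λ i → i) (h ∘ suc))))

module _ {m n} (G : BipGraph m n) where

  degX-support : ∀ x → degX G x ≡ length (support (G x))
  degX-support x = sum-indicator≡length-filter (G x) (allFin n)

  degY-support : ∀ y → degY G y ≡ length (support (λ x → G x y))
  degY-support y = sum-indicator≡length-filter (λ x → G x y) (allFin m)

degY-tail : ∀ {m n} (G : BipGraph (suc m) n) y → degY G y ≡ indicator (G zero y) + degY (tail G) y
degY-tail G y = sum-allFin-suc (λ x → indicator (G x y))

degY-tail≤ : ∀ {m n} (G : BipGraph (suc m) n) y → degY (tail G) y ≤ degY G y
degY-tail≤ G y = subst (degY (tail G) y ≤_) (sym (degY-tail G y)) (m≤n+m _ _)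

record Admissible {m n} (G : BipGraph m n) (L : ListAssignment m n) : Set where
  field
    degY≤2       : ∀ y → degY G y ≤ 2
    lists-unique : ∀ x y → Unique (L x y)
    lists-agree  : ∀ x y y′ → Edge G x y → Edge G x y′ → ∀ c → (c ∈ L x y) ⇔ (c ∈ L x y′)
    lists-long   : ∀ x y → Edge G x y → degX G x ⊔ degY G y ≤ length (L x y)

Admissible-tail : ∀ {m n} {G : BipGraph (suc m) n} {L} → Admissible G L → Admissible (tail G) (tail L)
Admissible-tail {G = G} adm = record
  { degY≤2       = λ y → ≤-trans (degY-tail≤ G y) (degY≤2 y)
  ; lists-unique = lists-unique ∘ suc
  ; lists-agree  = lists-agree ∘ suc
  ; lists-long   = λ x y e →
      ≤-trans (⊔-monoʳ-≤ (degX G (suc x)) (degY-tail≤ G y)) (lists-long (suc x) y e)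
  }
  where open Admissible adm

module Step {m n} {G : BipGraph (suc m) n} {L : ListAssignment (suc m) n} (adm : Admissible G L) where

  open Admissible adm
  open Representatives (Fin._≟_ {n})

  G′ : BipGraph m n
  G′ = tail G

  L′ : ListAssignment m n
  L′ = tail L

  tailColumn : Fin n → List (Fin m)
  tailColumn y = support (λ x → G′ x y)

  ∈-tailColumn⁺ : ∀ {x y} → Edge G′ x y → x ∈ tailColumn y
  ∈-tailColumn⁺ {y = y} = ∈-support⁺ {f = λ x → G′ x y}

  ∈-tailColumn⁻ : ∀ {x y} → x ∈ tailColumn y → Edge G′ x y
  ∈-tailColumn⁻ {y = y} = ∈-support⁻ {f = λ x → G′ x y}

  degY≡suc-tailColumn : ∀ {y} → Edge G zero y → degY G y ≡ suc (length (tailColumn y))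
  degY≡suc-tailColumn {y} e = begin
    degY G y                           ≡⟨ degY-tail G y ⟩
    indicator (G zero y) + degY G′ y   ≡⟨ cong (λ b → indicator b + degY G′ y) e ⟩
    suc (degY G′ y)                    ≡⟨ cong suc (degY-support G′ y) ⟩
    suc (length (tailColumn y))        ∎
    where open ≡-Reasoning

  tailColumn-small : ∀ {y} → Edge G zero y → length (tailColumn y) ≤ 1
  tailColumn-small {y} e = ≤-pred (subst (_≤ 2) (degY≡suc-tailColumn e) (degY≤2 y))

  degY≥2 : ∀ {x y} → Edge G zero y → Edge G′ x y → 2 ≤ degY G y
  degY≥2 e₀ e = subst (2 ≤_) (sym (degY≡suc-tailColumn e₀)) (s≤s (∈-length (∈-tailColumn⁺ e)))

  tail-neighbour-unique : ∀ {x x′ y} → Edge G zero y → Edge G′ x y → Edge G′ x′ y → x ≡ x′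
  tail-neighbour-unique e₀ e e′ = length≤1⇒≡ (tailColumn-small e₀) (∈-tailColumn⁺ e) (∈-tailColumn⁺ e′)

  record RowEnumeration (S : List (Fin n)) : Set where
    field
      sound    : ∀ {y} → y ∈ S → Edge G zero y
      complete : ∀ {y} → Edge G zero y → y ∈ S
      unique   : Unique S
      size     : length S ≤ degX G zero

  RowEnumeration-swap : ∀ {y y′ S} → RowEnumeration (y ∷ y′ ∷ S) → RowEnumeration (y′ ∷ y ∷ S)
  RowEnumeration-swap enum = record
    { sound = sound ∘ ⊆-swap
    ; complete = ⊆-swap ∘ complete
    ; unique = Unique-swap unique
    ; size = size
    }
    where open RowEnumeration enum

  module _ (π′ : Fin m → Fin n → ℕ) where

    forbidden : Fin n → List ℕ
    forbidden y = map (λ x → π′ x y) (tailColumn y)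

    forbidden-small : ∀ {y} → Edge G zero y → length (forbidden y) ≤ 1
    forbidden-small {y} e = subst (_≤ 1) (sym (length-map _ (tailColumn y))) (tailColumn-small e)

    forbidden-≡ : ∀ {x y c} → Edge G zero y → Edge G′ x y → c ∈ forbidden y → c ≡ π′ x y
    forbidden-≡ {y = y} e₀ e c∈ with x′ , x′∈ , refl ← ∈-map⁻ _ c∈ =
      cong (λ x → π′ x y) (tail-neighbour-unique e₀ (∈-tailColumn⁻ x′∈) e)

    record RowExtension (g : Fin n → ℕ) : Set where
      field
        inList    : ∀ {y} → Edge G zero y → g y ∈ L zero y
        distinct  : ∀ {y y′} → Edge G zero y → Edge G zero y′ → y ≢ y′ → g y ≢ g y′
        fresh     : ∀ {x y} → Edge G zero y → Edge G′ x y → g y ≢ π′ x y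

    proper-∷ : IsProperListColouring G′ L′ π′ → ∀ {g} → RowExtension g →
               IsProperListColouring G L (g ◂ π′)
    proper-∷ (inList′ , rowProper′ , columnProper′) {g} row = inList , rowProper , columnProper
      where
        open RowExtension row renaming (inList to inList₀; distinct to distinct₀)
        inList : ∀ x y → Edge G x y → (g ◂ π′) x y ∈ L x y
        inList zero y e = inList₀ e
        inList (suc x) y e = inList′ x y e
        rowProper : ∀ x y y′ → Edge G x y → Edge G x y′ → y ≢ y′ → (g ◂ π′) x y ≢ (g ◂ π′) x y′
        rowProper zero _ _ e e′ = distinct₀ e e′
        rowProper (suc x) y y′ = rowProper′ x y y′
        columnProper : ∀ x x′ y → Edge G x y → Edge G x′ y → x ≢ x′ → (g ◂ π′) x y ≢ (g ◂ π′) x′ y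
        columnProper zero zero _ _ _ x≢x′ = contradiction refl x≢x′
        columnProper zero (suc x′) _ e e′ _ = fresh e e′
        columnProper (suc x) zero _ e e′ _ = fresh e′ e ∘ sym
        columnProper (suc x) (suc x′) y e e′ x≢x′ = columnProper′ x x′ y e e′ (x≢x′ ∘ cong suc)

    sdr⇒row : ∀ {S y₀ g} → RowEnumeration S → Edge G zero y₀ →
              IsSDR (L zero y₀) forbidden S g → RowExtension g
    sdr⇒row {g = g} enum e₀ sdr = record
      { inList = λ {y} e → Equivalence.to (lists-agree zero _ y e₀ e (g y)) (chosen (complete e))
      ; distinct = λ e e′ → distinct (complete e) (complete e′)
      ; fresh = λ e e′ eq → avoids (complete e) (subst (_∈ forbidden _) (sym eq) (∈-map⁺ _ (∈-tailColumn⁺ e′)))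
      }
      where
        open RowEnumeration enum
        open IsSDR sdr

    row-empty : RowEnumeration [] → ∃ RowExtension
    row-empty enum = (λ _ → 0) , record
      { inList = λ e → absurd e ; distinct = λ e → absurd e ; fresh = λ e → absurd e }
      where
        absurd : ∀ {A : Set} {y} → Edge G zero y → A
        absurd e with () ← RowEnumeration.complete enum e

    fits : ∀ {y S} → RowEnumeration (y ∷ S) → length (y ∷ S) ≤ length (L zero y)
    fits {y} enum = ≤-trans size (≤-trans (m≤m⊔n _ _) (lists-long zero y (sound (here refl))))
      where open RowEnumeration enum

    row-free : ∀ {y S} → RowEnumeration (y ∷ S) → (∀ {x} → ¬ Edge G′ x y) → ∃ RowExtension
    row-free {y} {S} enum isolated =
      let g , sdr = sdr-free-head S (lists-unique zero y) unique (forbidden-small ∘ sound ∘ there) (fits enum)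
                      λ c∈ _ → let _ , x∈ , _ = ∈-map⁻ _ c∈ in isolated (∈-tailColumn⁻ x∈)
      in g , sdr⇒row enum (sound (here refl)) sdr
      where open RowEnumeration enum

    row-slack : ∀ {y x} → RowEnumeration (y ∷ []) → Edge G′ x y → ∃ RowExtension
    row-slack {y} enum e =
      let g , sdr = sdr-greedy (y ∷ []) (lists-unique zero y) unique λ { (here refl) → room }
      in g , sdr⇒row enum e₀ sdr
      where
        open RowEnumeration enum
        e₀ = sound (here refl)
        room : length (forbidden y) + 1 ≤ length (L zero y)
        room = ≤-trans (+-monoˡ-≤ 1 (forbidden-small e₀))
                 (≤-trans (degY≥2 e₀ e) (≤-trans (m≤n⊔m _ _) (lists-long zero y e₀)))

    row-differing : ∀ {y y′ S x x′} → RowEnumeration (y ∷ y′ ∷ S) → Edge G′ x y → Edge G′ x′ y′ →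
                 π′ x y ≢ π′ x′ y′ → ∃ RowExtension
    row-differing {y} {S = S} enum e e′ differ =
      let g , sdr = sdr-differing-heads S (lists-unique zero y) unique
                      (forbidden-small ∘ sound ∘ there) (fits enum)
                      (forbidden-≡ (sound (here refl)) e)
                      (differ ∘ forbidden-≡ (sound (there (here refl))) e′)
      in g , sdr⇒row enum (sound (here refl)) sdr
      where open RowEnumeration enum

  module Merge {y₁ y₂ : Fin n} {x₁ x₂ : Fin m} (y₁≢y₂ : y₁ ≢ y₂) (x₁≢x₂ : x₁ ≢ x₂)
               (e₁ : Edge G zero y₁) (e₂ : Edge G zero y₂)
               (e₁₁ : Edge G′ x₁ y₁) (e₂₂ : Edge G′ x₂ y₂) where

    -- Exchanging the columns y₁ and y₂ in row x₂ moves the edge x₂y₂ to x₂y₁.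
    ρ : Fin m → Permutation′ n
    ρ = updateAt (λ _ → Perm.id) x₂ (λ _ → Perm.transpose y₁ y₂)

    ρ-x₂ : ρ x₂ ≡ Perm.transpose y₁ y₂
    ρ-x₂ = updateAt-updates x₂ _

    ρ-other : ∀ {x} → x ≢ x₂ → ρ x ≡ Perm.id
    ρ-other {x} x≢x₂ = updateAt-minimal x x₂ _ x≢x₂

    G* : BipGraph m n
    G* x y = G′ x (ρ x ⟨$⟩ʳ y)

    L* : ListAssignment m n
    L* x y = L′ x (ρ x ⟨$⟩ʳ y)

    only-x₂ : ∀ {x} → Edge G′ x y₂ → x ≡ x₂
    only-x₂ e = tail-neighbour-unique e₂ e e₂₂

    ¬x₂y₁ : ¬ Edge G′ x₂ y₁
    ¬x₂y₁ e = x₁≢x₂ (tail-neighbour-unique e₁ e₁₁ e)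

    ρ-y₁ : ∀ x → Edge G zero (ρ x ⟨$⟩ʳ y₁)
    ρ-y₁ x with x Fin.≟ x₂
    ... | yes refl rewrite ρ-x₂ | transpose-here y₁ y₂ = e₂
    ... | no x≢x₂ rewrite ρ-other x≢x₂ = e₁

    ρ-fixes : ∀ {x y} → y ≢ y₁ → Edge G* x y → ρ x ⟨$⟩ʳ y ≡ y
    ρ-fixes {x} {y} y≢y₁ e with x Fin.≟ x₂
    ... | no x≢x₂ rewrite ρ-other x≢x₂ = refl
    ... | yes refl with y Fin.≟ y₂
    ...   | no y≢y₂ rewrite ρ-x₂ = transpose-other y≢y₁ y≢y₂
    ...   | yes refl rewrite ρ-x₂ | transpose-there y₁ y₂ = contradiction e ¬x₂y₁

    column-y₁ : ∀ {x} → Edge G* x y₁ → x ≡ x₁ ⊎ x ≡ x₂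
    column-y₁ {x} e with x Fin.≟ x₂
    ... | yes x≡x₂ = inj₂ x≡x₂
    ... | no x≢x₂ rewrite ρ-other x≢x₂ = inj₁ (tail-neighbour-unique e₁ e e₁₁)

    degY*-y₁ : degY G* y₁ ≤ 2
    degY*-y₁ = subst (_≤ 2) (sym (degY-support G* y₁))
      (length-mono-⊆ {ys = x₁ ∷ x₂ ∷ []} (support-unique {f = λ x → G* x y₁}) λ x∈ →
        case column-y₁ (∈-support⁻ {f = λ x → G* x y₁} x∈) of λ where
          (inj₁ refl) → here refl
          (inj₂ refl) → there (here refl))

    degY*-other : ∀ {y} → y ≢ y₁ → degY G* y ≤ degY G y
    degY*-other {y} y≢y₁ = begin
      degY G* y                     ≡⟨ degY-support G* y ⟩
      length (support λ x → G* x y) ≤⟨ length-support-mono {f = λ x → G* x y} column⊆ ⟩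
      length (support λ x → G′ x y) ≡⟨ degY-support G′ y ⟨
      degY G′ y                     ≤⟨ degY-tail≤ G y ⟩
      degY G y                      ∎
      where
        open ≤-Reasoning
        column⊆ : ∀ {x} → Edge G* x y → Edge G′ x y
        column⊆ {x} e = subst (Edge G′ x) (ρ-fixes y≢y₁ e) e

    degX*≤ : ∀ x → degX G* x ≤ degX G (suc x)
    degX*≤ x = begin
      degX G* x                                  ≡⟨ degX-support G* x ⟩
      length (support (G (suc x) ∘ (ρ x ⟨$⟩ʳ_))) ≤⟨ length-support-∘ (G (suc x)) (⟨$⟩ʳ-injective (ρ x)) ⟩
      length (support (G (suc x)))               ≡⟨ degX-support G (suc x) ⟨
      degX G (suc x)                             ∎
      where open ≤-Reasoning

    admissible : Admissible G* L*
    admissible = record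
      { degY≤2 = degY*≤2
      ; lists-unique = λ x y → lists-unique (suc x) _
      ; lists-agree = λ x y y′ → lists-agree (suc x) _ _
      ; lists-long = λ x y e →
          ⊔-lub (≤-trans (degX*≤ x) (≤-trans (m≤m⊔n _ _) (lists-long (suc x) _ e))) (degY*-long e)
      }
      where
        degY*≤2 : ∀ y → degY G* y ≤ 2
        degY*≤2 y with y Fin.≟ y₁
        ... | yes refl = degY*-y₁
        ... | no y≢y₁ = ≤-trans (degY*-other y≢y₁) (degY≤2 y)
        degY*-long : ∀ {x y} → Edge G* x y → degY G* y ≤ length (L* x y)
        degY*-long {x} {y} e with y Fin.≟ y₁
        ... | yes refl =
          ≤-trans degY*-y₁ (≤-trans (degY≥2 (ρ-y₁ x) e) (≤-trans (m≤n⊔m _ _) (lists-long (suc x) _ e)))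
        ... | no y≢y₁ = subst (λ z → degY G* y ≤ length (L (suc x) z)) (sym fixed)
            (≤-trans (degY*-other y≢y₁) (≤-trans (m≤n⊔m _ _) (lists-long (suc x) y e′)))
          where
            fixed = ρ-fixes y≢y₁ e
            e′ = subst (Edge G (suc x)) fixed e

    ρˡ-fixes : ∀ {x y} → Edge G′ x y → y ≢ y₂ → ρ x ⟨$⟩ˡ y ≡ y
    ρˡ-fixes {x} {y} e y≢y₂ with x Fin.≟ x₂
    ... | no x≢x₂ rewrite ρ-other x≢x₂ = refl
    ... | yes refl rewrite ρ-x₂ = transpose-other y≢y₂ λ { refl → ¬x₂y₁ e }

    ρˡ-x₂y₂ : ρ x₂ ⟨$⟩ˡ y₂ ≡ y₁
    ρˡ-x₂y₂ = trans (cong (_⟨$⟩ˡ y₂) ρ-x₂) (transpose-here y₂ y₁)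

    unmerge : ∀ {π*} → IsProperListColouring G* L* π* →
               ∃ λ π′ → IsProperListColouring G′ L′ π′ × π′ x₁ y₁ ≢ π′ x₂ y₂
    unmerge {π*} (inList* , rowProper* , columnProper*) =
      π′ , (inList′ , rowProper′ , columnProper′) , differ
      where
        π′ : Fin m → Fin n → ℕ
        π′ x y = π* x (ρ x ⟨$⟩ˡ y)

        edge* : ∀ {x y} → Edge G′ x y → Edge G* x (ρ x ⟨$⟩ˡ y)
        edge* {x} = subst (Edge G′ x) (sym (inverseʳ (ρ x)))

        relabel : ∀ {x y z} → Edge G′ x y → ρ x ⟨$⟩ˡ y ≡ z → Edge G* x z × π′ x y ≡ π* x z
        relabel e refl = edge* e , refl

        inList′ : ∀ x y → Edge G′ x y → π′ x y ∈ L′ x y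
        inList′ x y e = subst (λ z → π′ x y ∈ L′ x z) (inverseʳ (ρ x)) (inList* x _ (edge* e))

        rowProper′ : ∀ x y y′ → Edge G′ x y → Edge G′ x y′ → y ≢ y′ → π′ x y ≢ π′ x y′
        rowProper′ x y y′ e e′ y≢y′ = rowProper* x _ _ (edge* e) (edge* e′) (y≢y′ ∘ ⟨$⟩ˡ-injective (ρ x))

        columnProper′ : ∀ x x′ y → Edge G′ x y → Edge G′ x′ y → x ≢ x′ → π′ x y ≢ π′ x′ y
        columnProper′ x x′ y e e′ x≢x′ with y Fin.≟ y₂
        ... | yes refl = contradiction (trans (only-x₂ e) (sym (only-x₂ e′))) x≢x′
        ... | no y≢y₂ =
          let e* , π′≡ = relabel e (ρˡ-fixes e y≢y₂)
              e*′ , π′≡′ = relabel e′ (ρˡ-fixes e′ y≢y₂)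
          in λ eq → columnProper* x x′ y e* e*′ x≢x′ (trans (sym π′≡) (trans eq π′≡′))

        differ : π′ x₁ y₁ ≢ π′ x₂ y₂
        differ eq =
          let e* , π′≡ = relabel e₁₁ (ρˡ-fixes e₁₁ y₁≢y₂)
              e*′ , π′≡′ = relabel e₂₂ ρˡ-x₂y₂
          in columnProper* x₁ x₂ y₁ e* e*′ x₁≢x₂ (trans (sym π′≡) (trans eq π′≡′))

  tail-neighbour? : ∀ y → Dec (∃ λ x → Edge G′ x y)
  tail-neighbour? y = Fin.any? (λ x → G′ x y Bool.≟ true)

  step : (∀ (H : BipGraph m n) (K : ListAssignment m n) → Admissible H K → ∃ (IsProperListColouring H K)) →
         ∃ (IsProperListColouring G L)
  step colourable = extend (support (G zero)) neighbourhood
    where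
      neighbourhood : RowEnumeration (support (G zero))
      neighbourhood = record
        { sound = ∈-support⁻ {f = G zero}
        ; complete = ∈-support⁺ {f = G zero}
        ; unique = support-unique {f = G zero}
        ; size = ≤-reflexive (sym (degX-support G zero))
        }

      with-row : ∀ {π′} → IsProperListColouring G′ L′ π′ → ∃ (RowExtension π′) →
                 ∃ (IsProperListColouring G L)
      with-row {π′} proper (g , row) = g ◂ π′ , proper-∷ π′ proper row

      with-tail-row : (∀ {π′} → IsProperListColouring G′ L′ π′ → ∃ (RowExtension π′)) →
                      ∃ (IsProperListColouring G L)
      with-tail-row row =
        let _ , proper = colourable G′ L′ (Admissible-tail adm) in with-row proper (row proper)

      extend : ∀ S → RowEnumeration S → ∃ (IsProperListColouring G L)
      extend [] enum = with-tail-row λ {π′} _ → row-empty π′ enum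
      extend (y ∷ S) enum with tail-neighbour? y
      ... | no isolated = with-tail-row λ {π′} _ → row-free π′ enum (λ e → isolated (_ , e))
      extend (y ∷ []) enum | yes (x , e) = with-tail-row λ {π′} _ → row-slack π′ enum e
      extend (y ∷ y′ ∷ S) enum | yes (x , e) with tail-neighbour? y′
      ... | no isolated =
        with-tail-row λ {π′} _ → row-free π′ (RowEnumeration-swap enum) (λ e′ → isolated (_ , e′))
      ... | yes (x′ , e′) with x Fin.≟ x′
      ...   | yes refl =
        with-tail-row λ {π′} (_ , rowProper , _) → row-differing π′ enum e e′ (rowProper x y y′ e e′ y≢y′)
        where y≢y′ = All.head (AllPairs.head (RowEnumeration.unique enum))
      ...   | no x≢x′ =
        let open Merge y≢y′ x≢x′ (sound (here refl)) (sound (there (here refl))) e e′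
            π′ , proper , differ = unmerge (proj₂ (colourable G* L* admissible))
        in with-row proper (row-differing π′ enum e e′ differ)
        where
          open RowEnumeration enum
          y≢y′ = All.head (AllPairs.head unique)

colourable : ∀ m {n} (G : BipGraph m n) (L : ListAssignment m n) → Admissible G L →
             ∃ (IsProperListColouring G L)
colourable zero G L _ = (λ _ _ → 0) , (λ ()) , (λ ()) , (λ ())
colourable (suc m) G L adm = Step.step adm (colourable m)

lemma6 : ∀ {m n} (G : BipGraph m n) (L : ListAssignment m n) →
    (∀ y → ¬ (3 ≤ degY G y)) →
    (∀ x y → Unique (L x y)) →
    (∀ x y y′ → Edge G x y → Edge G x y′ → ∀ c → (c ∈ L x y) ⇔ (c ∈ L x y′)) →
    (∀ x y → Edge G x y → degX G x ⊔ degY G y ≤ length (L x y)) →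
    ∃ λ π → IsProperListColouring G L π
lemma6 G L degY<3 unique agree long = colourable _ G L record
  { degY≤2 = λ y → ≤-pred (≰⇒> (degY<3 y))
  ; lists-unique = unique
  ; lists-agree = agree
  ; lists-long = long
  }
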